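{- For each $n\in\{1,\ldots,8\}$ and every integer $m\ge n$: \begin{align*} c_{1,m}(1)&=1,\\ c_{2,m}(1)&=\tbinom{m}{1},\\ c_{3,m}(1)&=\tbinom{m}{1}+\tbinom{m}{2},\\ c_{4,m}(1)&=\tbinom{m}{1}+4\tbinom{m}{2}+\tbinom{m}{3},\\ c_{5,m}(1)&=\tbinom{m}{1}+8\tbinom{m}{2}+13\tbinom{m}{3}+\tbinom{m}{4},\\ c_{6,m}(1)&=\tbinom{m}{1}+18\tbinom{m}{2}+48\tbinom{m}{3}+41\tbinom{m}{4}+\tbinom{m}{5},\\ c_{7,m}(1)&=\tbinom{m}{1}+33\tbinom{m}{2}+178\tbinom{m}{3}+262\tbinom{m}{4}+131\tbinom{m}{5}+\tbinom{m}{6},\\ c_{8,m}(1)&=\tbinom{m}{1}+68\tbinom{m}{2}+549\tbinom{m}{3}+1480\tbinom{m}{4}+1405\tbinom{m}{5}+428\tbinom{m}{6}+\tbinom{m}{7}. \end{align*}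
   Context: $c_{n,m}(1)$ is the number of words $w\in\{1,\ldots,m\}^n$ such that $1w\equiv w1$, where $\equiv$ is Knuth equivalence (equivalently, $P(1w)=P(w1)$ for RSK insertion tableaux). -}

module Defs where

open import Data.Nat using (ℕ; zero; suc; _<ᵇ_)
open import Data.Bool using (if_then_else_)
open import Data.List using (List; []; _∷_; _∷ʳ_; map; concatMap; foldl; filter; length; upTo)
open import Data.List.Properties using (≡-dec)
open import Data.Maybe using (Maybe; just; nothing)
open import Data.Product using (_×_; _,_)
open import Relation.Binary.PropositionalEquality using (_≡_)
open import Relation.Nullary using (Dec)
import Data.Nat as N

letters : ℕ → List ℕ
letters m = map suc (upTo m)

words : ℕ → ℕ → List (List ℕ)
words zero    m = [] ∷ []
words (suc n) m = concatMap (λ a → map (a ∷_) (words n m)) (letters m)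

-- A tableau is a list of rows (top row first), each row weakly increasing.
Tableau : Set
Tableau = List (List ℕ)

rowInsert : ℕ → List ℕ → List ℕ × Maybe ℕ
rowInsert x [] = x ∷ [] , nothing
rowInsert x (y ∷ r) with x <ᵇ y
... | Data.Bool.true  = x ∷ r , just y
... | Data.Bool.false with rowInsert x r
...   | r' , b = y ∷ r' , b

insertT : ℕ → Tableau → Tableau
insertT x [] = (x ∷ []) ∷ []
insertT x (row ∷ rows) with rowInsert x row
... | row' , nothing = row' ∷ rows
... | row' , just y  = row' ∷ insertT y rows

P : List ℕ → Tableau
P w = foldl (λ T x → insertT x T) [] w

_≟T_ : (S T : Tableau) → Dec (S ≡ T)
_≟T_ = ≡-dec (≡-dec N._≟_)

c1 : ℕ → ℕ → ℕ
c1 n m = length (filter (λ w → P (1 ∷ w) ≟T P (w ∷ʳ 1)) (words n m))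

-- Inserting 1 in front of a word w of positive letters puts it at the start of the first row
-- of P(w), where it stays; appending it instead bumps the leftmost entry of that row exceeding 1.
-- So 1w ≡ w1 iff the first row of P(w) consists of 1s, a property of row insertion alone that
-- is invariant under order-preserving relabellings fixing 1.
--
-- Let G(m, j) count such words of length n over {1,…,m+j} containing each of m+1,…,m+j.
-- Splitting on whether m+1 occurs, and relabelling when it does not, gives Pascal's recurrence
-- G(m+1, j) = G(m, j) + G(m, j+1) for m ≥ 1.  Prepending a row b with b_j + b_{j+1} = G(1, j)
-- turns c_{n,m+1}(1) = G(m+1, 0) into the binomial transform ∑ₖ bₖ C(m+1, k).
--
-- Every letter lowers (entries ≠ 1 in the first row) + (letters still missing) by at most one,
-- so G(1, j) = 0 for j > n, and the values G(1, j), j ≤ n, are computed by a search pruned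
-- by this bound.

module Submission where

open import Defs
open import Data.Bool using (Bool; true; false; T; if_then_else_; not; _∧_; _∨_)
open import Data.Bool.ListAction using (any; all)
open import Data.Bool.Properties using (∧-identityʳ; ∧-zeroʳ; ∧-assoc; ∧-comm)
open import Data.List
  using (List; []; _∷_; _∷ʳ_; _++_; length; map; foldl; null; filter; concatMap; iterate; applyUpTo; zipWith)
open import Data.List.Properties
  using (∷-injective; ∷-injectiveˡ; ∷-injectiveʳ; map-cong; map-cong-local; map-id-local; map-∘; map-++;
         map-applyUpTo; applyUpTo-∷ʳ; foldl-∷ʳ; filter-++; filter-all; filter-accept; filter-reject; length-++; length-iterate)
open import Data.List.Relation.Unary.All as All using (All; []; _∷_)
import Data.List.Relation.Unary.All.Properties as All
open import Data.List.Relation.Unary.AllPairs as AllPairs using ()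
open import Data.List.Relation.Unary.Unique.Propositional using (Unique)
import Data.List.Relation.Unary.Unique.Propositional.Properties as Unique
open import Data.Maybe using (Maybe; just; nothing)
open import Data.Nat
open import Data.Nat.Combinatorics using (_C_; nCk+nC[k+1]≡[n+1]C[k+1])
open import Data.Nat.ListAction using (sum)
open import Data.Nat.ListAction.Properties using (sum-++)
open import Data.Nat.Properties
open import Algebra.Properties.CommutativeSemigroup +-commutativeSemigroup using (interchange)
open import Data.Product using (_×_; _,_; proj₁; proj₂)
open import Function using (_∘_)
open import Function.Definitions using (Injective)
open import Relation.Binary.PropositionalEquality
open import Relation.Nullary using (Dec; yes; no; does; ¬?; contradiction)
open import Relation.Nullary.Decidable using (dec-true; dec-false)

open ≡-Reasoning

-- Binomial sums

∑ : ℕ → (ℕ → ℕ) → ℕ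
∑ n f = sum (applyUpTo f n)

∑-cong : ∀ n {f g : ℕ → ℕ} → (∀ k → f k ≡ g k) → ∑ n f ≡ ∑ n g
∑-cong zero    f≗g = refl
∑-cong (suc n) f≗g = cong₂ _+_ (f≗g 0) (∑-cong n (f≗g ∘ suc))

∑-+ : ∀ n (f g : ℕ → ℕ) → ∑ n (λ k → f k + g k) ≡ ∑ n f + ∑ n g
∑-+ zero    f g = refl
∑-+ (suc n) f g = trans (cong (f 0 + g 0 +_) (∑-+ n (f ∘ suc) (g ∘ suc))) (interchange (f 0) (g 0) _ _)

∑-zero : ∀ n → ∑ n (λ _ → 0) ≡ 0
∑-zero zero    = refl
∑-zero (suc n) = ∑-zero n

∑-suc : ∀ n {f : ℕ → ℕ} → f n ≡ 0 → ∑ (suc n) f ≡ ∑ n f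
∑-suc n {f} fn≡0 = begin
  sum (applyUpTo f (suc n))       ≡⟨ cong sum (applyUpTo-∷ʳ f n) ⟨
  sum (applyUpTo f n ∷ʳ f n)      ≡⟨ sum-++ (applyUpTo f n) (f n ∷ []) ⟩
  ∑ n f + (f n + 0)               ≡⟨ cong (λ x → ∑ n f + (x + 0)) fn≡0 ⟩
  ∑ n f + 0                       ≡⟨ +-identityʳ _ ⟩
  ∑ n f                           ∎

∑-C0 : ∀ N (b : ℕ → ℕ) → b N ≡ 0 → ∑ N (λ k → b k * (0 C k)) ≡ b 0
∑-C0 zero    b b0≡0 = sym b0≡0
∑-C0 (suc N) b _    = begin
  b 0 * 1 + ∑ N (λ k → b (suc k) * 0)  ≡⟨ cong₂ _+_ (*-identityʳ (b 0)) (∑-cong N (*-zeroʳ ∘ b ∘ suc)) ⟩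
  b 0 + ∑ N (λ _ → 0)                  ≡⟨ cong (b 0 +_) (∑-zero N) ⟩
  b 0 + 0                              ≡⟨ +-identityʳ (b 0) ⟩
  b 0                                  ∎

∑-pascal : ∀ N m (b : ℕ → ℕ) → b N ≡ 0 →
           ∑ N (λ k → b k * (suc m C k)) ≡ ∑ N (λ k → b k * (m C k)) + ∑ N (λ k → b (suc k) * (m C k))
∑-pascal zero    m b _    = refl
∑-pascal (suc N) m b bN≡0 = begin
  b 0 * 1 + ∑ N (λ k → b (suc k) * (suc m C suc k))
    ≡⟨ cong (b 0 * 1 +_) (∑-cong N split) ⟩
  b 0 * 1 + ∑ N (λ k → b (suc k) * (m C k) + b (suc k) * (m C suc k))
    ≡⟨ cong (b 0 * 1 +_) (∑-+ N _ _) ⟩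
  b 0 * 1 + (∑ N (λ k → b (suc k) * (m C k)) + ∑ N (λ k → b (suc k) * (m C suc k)))
    ≡⟨ cong (b 0 * 1 +_) (+-comm (∑ N (λ k → b (suc k) * (m C k))) _) ⟩
  b 0 * 1 + (∑ N (λ k → b (suc k) * (m C suc k)) + ∑ N (λ k → b (suc k) * (m C k)))
    ≡⟨ +-assoc (b 0 * 1) _ _ ⟨
  ∑ (suc N) (λ k → b k * (m C k)) + ∑ N (λ k → b (suc k) * (m C k))
    ≡⟨ cong (∑ (suc N) (λ k → b k * (m C k)) +_) (∑-suc N (cong (_* (m C N)) bN≡0)) ⟨
  ∑ (suc N) (λ k → b k * (m C k)) + ∑ (suc N) (λ k → b (suc k) * (m C k)) ∎
  where
  split : ∀ k → b (suc k) * (suc m C suc k) ≡ b (suc k) * (m C k) + b (suc k) * (m C suc k)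
  split k = trans (cong (b (suc k) *_) (sym (nCk+nC[k+1]≡[n+1]C[k+1] m k))) (*-distribˡ-+ (b (suc k)) (m C k) _)

binomial-transform : ∀ N (G : ℕ → ℕ → ℕ) → (∀ j → N ≤ j → G 0 j ≡ 0) →
                     (∀ m j → G (suc m) j ≡ G m j + G m (suc j)) →
                     ∀ m j → G m j ≡ ∑ N (λ k → G 0 (j + k) * (m C k))
binomial-transform N G support pascal zero j = begin
  G 0 j                              ≡⟨ cong (G 0) (+-identityʳ j) ⟨
  G 0 (j + 0)                        ≡⟨ ∑-C0 N (G 0 ∘ (j +_)) (support (j + N) (m≤n+m N j)) ⟨
  ∑ N (λ k → G 0 (j + k) * (0 C k))  ∎
binomial-transform N G support pascal (suc m) j = begin
  G (suc m) j
    ≡⟨ pascal m j ⟩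
  G m j + G m (suc j)
    ≡⟨ cong₂ _+_ (binomial-transform N G support pascal m j) (binomial-transform N G support pascal m (suc j)) ⟩
  ∑ N (λ k → G 0 (j + k) * (m C k)) + ∑ N (λ k → G 0 (suc j + k) * (m C k))
    ≡⟨ cong (∑ N (λ k → G 0 (j + k) * (m C k)) +_) (∑-cong N λ k → cong (λ i → G 0 i * (m C k)) (+-suc j k)) ⟨
  ∑ N (λ k → G 0 (j + k) * (m C k)) + ∑ N (λ k → G 0 (j + suc k) * (m C k))
    ≡⟨ ∑-pascal N m (G 0 ∘ (j +_)) (support (j + N) (m≤n+m N j)) ⟨
  ∑ N (λ k → G 0 (j + k) * (suc m C k)) ∎

coeff : List ℕ → ℕ → ℕ
coeff []       _       = 0
coeff (b ∷ bs) zero    = b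
coeff (b ∷ bs) (suc k) = coeff bs k

coeff-≥ : ∀ bs {k} → length bs ≤ k → coeff bs k ≡ 0
coeff-≥ []       _       = refl
coeff-≥ (b ∷ bs) (s≤s p) = coeff-≥ bs p

_⋆_ : ℕ → ℕ → ℕ
1 ⋆ x = x
b ⋆ x = b * x

⋆≡* : ∀ b x → b ⋆ x ≡ b * x
⋆≡* 0             x = refl
⋆≡* 1             x = sym (+-identityʳ x)
⋆≡* (suc (suc b)) x = refl

-- ∑ₖ bₖ (m C k), bracketed to the left and with 1 ⋆ x = x, so that for literal coefficients
-- it unfolds definitionally to the way such sums are usually written.
binomialSum : List ℕ → ℕ → ℕ
binomialSum bs m = foldl _+_ 0 (zipWith _⋆_ bs (applyUpTo (m C_) (length bs)))

foldl-+ : ∀ a xs → foldl _+_ a xs ≡ a + sum xs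
foldl-+ a []       = sym (+-identityʳ a)
foldl-+ a (x ∷ xs) = trans (foldl-+ (a + x) xs) (+-assoc a x (sum xs))

sum-zipWith-⋆ : ∀ bs (f : ℕ → ℕ) →
                sum (zipWith _⋆_ bs (applyUpTo f (length bs))) ≡ ∑ (length bs) (λ k → coeff bs k * f k)
sum-zipWith-⋆ []       f = refl
sum-zipWith-⋆ (b ∷ bs) f = cong₂ _+_ (⋆≡* b (f 0)) (sum-zipWith-⋆ bs (f ∘ suc))

binomialSum≡∑ : ∀ bs m → binomialSum bs m ≡ ∑ (length bs) (λ k → coeff bs k * (m C k))
binomialSum≡∑ bs m = trans (foldl-+ 0 (zipWith _⋆_ bs (applyUpTo (m C_) (length bs)))) (sum-zipWith-⋆ bs (m C_))

-- Counting words

sum-map-+ : ∀ {A : Set} (f g : A → ℕ) xs → sum (map (λ x → f x + g x) xs) ≡ sum (map f xs) + sum (map g xs)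
sum-map-+ f g []       = refl
sum-map-+ f g (x ∷ xs) = trans (cong (f x + g x +_) (sum-map-+ f g xs)) (interchange (f x) (g x) _ _)

sum-map-zero : ∀ {A : Set} {f : A → ℕ} {xs} → All (λ x → f x ≡ 0) xs → sum (map f xs) ≡ 0
sum-map-zero []             = refl
sum-map-zero (fx≡0 ∷ fxs≡0) = cong₂ _+_ fx≡0 (sum-map-zero fxs≡0)

count : ℕ → List ℕ → (List ℕ → Bool) → ℕ
count zero    L p = if p [] then 1 else 0
count (suc n) L p = sum (map (λ a → count n L (p ∘ (a ∷_))) L)

count-cong : ∀ n L {p q : List ℕ → Bool} → (∀ w → p w ≡ q w) → count n L p ≡ count n L q
count-cong zero    L p≗q = cong (if_then 1 else 0) (p≗q [])
count-cong (suc n) L p≗q = cong sum (map-cong (λ a → count-cong n L (p≗q ∘ (a ∷_))) L)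

count-cong-All : ∀ n {P : ℕ → Set} {L} {p q : List ℕ → Bool} →
                 All P L → (∀ w → All P w → p w ≡ q w) → count n L p ≡ count n L q
count-cong-All zero    _  p≗q = cong (if_then 1 else 0) (p≗q [] [])
count-cong-All (suc n) PL p≗q =
  cong sum (map-cong-local (All.map (λ {a} Pa → count-cong-All n PL (λ w Pw → p≗q (a ∷ w) (Pa ∷ Pw))) PL))

count-false : ∀ n L {p : List ℕ → Bool} → (∀ w → p w ≡ false) → count n L p ≡ 0
count-false zero    L p≡false = cong (if_then 1 else 0) (p≡false [])
count-false (suc n) L p≡false = sum-map-zero (All.universal (λ a → count-false n L (p≡false ∘ (a ∷_))) L)

count-split : ∀ n L (p c : List ℕ → Bool) →
              count n L p ≡ count n L (λ w → p w ∧ c w) + count n L (λ w → p w ∧ not (c w))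
count-split zero L p c with p [] | c []
... | false | _     = refl
... | true  | true  = refl
... | true  | false = refl
count-split (suc n) L p c =
  trans (cong sum (map-cong (λ a → count-split n L (p ∘ (a ∷_)) (c ∘ (a ∷_))) L)) (sum-map-+ _ _ L)

count-map : ∀ n (f : ℕ → ℕ) L p → count n (map f L) p ≡ count n L (p ∘ map f)
count-map zero    f L p = refl
count-map (suc n) f L p = begin
  sum (map (λ b → count n (map f L) (p ∘ (b ∷_))) (map f L))
    ≡⟨ cong sum (map-∘ L) ⟨
  sum (map (λ a → count n (map f L) (p ∘ (f a ∷_))) L)
    ≡⟨ cong sum (map-cong (λ a → count-map n f L (p ∘ (f a ∷_))) L) ⟩
  sum (map (λ a → count n L (p ∘ (f a ∷_) ∘ map f)) L) ∎

length-filter-map : ∀ {A B : Set} {P : B → Set} (P? : ∀ y → Dec (P y)) (g : A → B) xs →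
                    length (filter P? (map g xs)) ≡ length (filter (P? ∘ g) xs)
length-filter-map P? g []       = refl
length-filter-map P? g (x ∷ xs) with does (P? (g x))
... | true  = cong suc (length-filter-map P? g xs)
... | false = length-filter-map P? g xs

length-filter-words : ∀ n m {P : List ℕ → Set} (P? : ∀ w → Dec (P w)) →
                      length (filter P? (words n m)) ≡ count n (letters m) (does ∘ P?)
length-filter-words zero m P? with does (P? [])
... | true  = refl
... | false = refl
length-filter-words (suc n) m P? = go (letters m)
  where
  go : ∀ K → length (filter P? (concatMap (λ a → map (a ∷_) (words n m)) K))
           ≡ sum (map (λ a → count n (letters m) (does ∘ P? ∘ (a ∷_))) K)
  go []      = refl
  go (a ∷ K) = begin
    length (filter P? (map (a ∷_) (words n m) ++ concatMap (λ a → map (a ∷_) (words n m)) K))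
      ≡⟨ cong length (filter-++ P? (map (a ∷_) (words n m)) _) ⟩
    length (filter P? (map (a ∷_) (words n m)) ++ filter P? (concatMap (λ a → map (a ∷_) (words n m)) K))
      ≡⟨ length-++ (filter P? (map (a ∷_) (words n m))) ⟩
    length (filter P? (map (a ∷_) (words n m))) + length (filter P? (concatMap (λ a → map (a ∷_) (words n m)) K))
      ≡⟨ cong₂ _+_ (trans (length-filter-map P? (a ∷_) (words n m)) (length-filter-words n m (P? ∘ (a ∷_)))) (go K) ⟩
    count n (letters m) (does ∘ P? ∘ (a ∷_)) + sum (map (λ a → count n (letters m) (does ∘ P? ∘ (a ∷_))) K) ∎

-- Occurrences of letters

≡ᵇ-sym : ∀ x y → (x ≡ᵇ y) ≡ (y ≡ᵇ x)
≡ᵇ-sym zero    zero    = refl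
≡ᵇ-sym zero    (suc y) = refl
≡ᵇ-sym (suc x) zero    = refl
≡ᵇ-sym (suc x) (suc y) = ≡ᵇ-sym x y

occurs : ℕ → List ℕ → Bool
occurs a = any (_≡ᵇ a)

covers : List ℕ → List ℕ → Bool
covers R w = all (λ a → occurs a w) R

remove : ℕ → List ℕ → List ℕ
remove a = filter (λ x → ¬? (x ≟ a))

remove-all : ∀ {a xs} → All (_≢ a) xs → remove a xs ≡ xs
remove-all {a} = filter-all (λ x → ¬? (x ≟ a))

remove-head : ∀ a xs → remove a (a ∷ xs) ≡ remove a xs
remove-head a xs = filter-reject (λ x → ¬? (x ≟ a)) (λ a≢a → a≢a refl)

remove-other : ∀ {a x} xs → x ≢ a → remove a (x ∷ xs) ≡ x ∷ remove a xs
remove-other {a} _ = filter-accept (λ x → ¬? (x ≟ a))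

missing : List ℕ → List ℕ → List ℕ
missing = foldl (λ R b → remove b R)

covers-remove : ∀ b R w → covers (remove b R) w ≡ covers R (b ∷ w)
covers-remove b []      w = refl
covers-remove b (r ∷ R) w rewrite ≡ᵇ-sym b r with r ≡ᵇ b
... | true  = covers-remove b R w
... | false = cong (occurs r w ∧_) (covers-remove b R w)

null-missing : ∀ R w → null (missing R w) ≡ covers R w
null-missing []      []      = refl
null-missing (_ ∷ _) []      = refl
null-missing R       (b ∷ w) = trans (null-missing (remove b R) w) (covers-remove b R w)

module _ {f : ℕ → ℕ} (f-injective : Injective _≡_ _≡_ f) where

  ≡ᵇ-injective : ∀ x y → (f x ≡ᵇ f y) ≡ (x ≡ᵇ y)
  ≡ᵇ-injective x y with x ≟ y
  ... | yes refl = trans (dec-true (f x ≟ f x) refl) (sym (dec-true (x ≟ x) refl))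
  ... | no  x≢y  = trans (dec-false (f x ≟ f y) (x≢y ∘ f-injective)) (sym (dec-false (x ≟ y) x≢y))

  occurs-map : ∀ a w → occurs (f a) (map f w) ≡ occurs a w
  occurs-map a []      = refl
  occurs-map a (b ∷ w) = cong₂ _∨_ (≡ᵇ-injective b a) (occurs-map a w)

  covers-map : ∀ R w → covers (map f R) (map f w) ≡ covers R w
  covers-map []      w = refl
  covers-map (a ∷ R) w = cong₂ _∧_ (occurs-map a w) (covers-map R w)

count-avoid : ∀ n L p a → count n L (λ w → p w ∧ not (occurs a w)) ≡ count n (remove a L) p
count-avoid zero    L p a = cong (if_then 1 else 0) (∧-identityʳ (p []))
count-avoid (suc n) L p a = go L
  where
  go : ∀ K → sum (map (λ b → count n L (λ w → p (b ∷ w) ∧ not ((b ≡ᵇ a) ∨ occurs a w))) K)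
           ≡ sum (map (λ b → count n (remove a L) (p ∘ (b ∷_))) (remove a K))
  go []      = refl
  go (b ∷ K) with b ≡ᵇ a
  ... | true  = trans (cong (_+ _) (count-false n L (λ w → ∧-zeroʳ (p (b ∷ w))))) (go K)
  ... | false = cong₂ _+_ (count-avoid n L (p ∘ (b ∷_)) a) (go K)

-- Intervals and their order embeddings

range : ℕ → ℕ → List ℕ
range = iterate suc

applyUpTo≡range : ∀ c k {f : ℕ → ℕ} → (∀ i → f i ≡ c + i) → applyUpTo f k ≡ range c k
applyUpTo≡range c zero    f≗ = refl
applyUpTo≡range c (suc k) f≗ =
  cong₂ _∷_ (trans (f≗ 0) (+-identityʳ c)) (applyUpTo≡range (suc c) k (λ i → trans (f≗ (suc i)) (+-suc c i)))

letters≡range : ∀ m → letters m ≡ range 1 m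
letters≡range m = trans (map-applyUpTo (λ i → i) suc m) (applyUpTo≡range 1 m (λ _ → refl))

range-++ : ∀ a k l → range a (k + l) ≡ range a k ++ range (a + k) l
range-++ a zero    l = cong (λ c → range c l) (sym (+-identityʳ a))
range-++ a (suc k) l = cong (a ∷_) (trans (range-++ (suc a) k l) (cong (λ c → range (suc a) k ++ range c l) (sym (+-suc a k))))

range-≥ : ∀ c k → All (c ≤_) (range c k)
range-≥ c zero    = []
range-≥ c (suc k) = ≤-refl ∷ All.map <⇒≤ (range-≥ (suc c) k)

range-< : ∀ c k → All (_< c + k) (range c k)
range-< c zero    = []
range-< c (suc k) = m<m+n c z<s ∷ subst (λ n → All (_< n) (range (suc c) k)) (sym (+-suc c k)) (range-< (suc c) k)

range-unique : ∀ c k → Unique (range c k)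
range-unique c zero    = AllPairs.[]
range-unique c (suc k) = All.map <⇒≢ (range-≥ (suc c) k) AllPairs.∷ range-unique (suc c) k

skip : ℕ → ℕ → ℕ
skip zero    x       = suc x
skip (suc M) zero    = zero
skip (suc M) (suc x) = suc (skip M x)

skip-<ᵇ : ∀ M x y → (skip M x <ᵇ skip M y) ≡ (x <ᵇ y)
skip-<ᵇ zero    x       y       = refl
skip-<ᵇ (suc M) zero    zero    = refl
skip-<ᵇ (suc M) zero    (suc y) = refl
skip-<ᵇ (suc M) (suc x) zero    = refl
skip-<ᵇ (suc M) (suc x) (suc y) = skip-<ᵇ M x y

skip-injective : ∀ M → Injective _≡_ _≡_ (skip M)
skip-injective zero    {x}     {y}     eq = suc-injective eq
skip-injective (suc M) {zero}  {zero}  eq = refl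
skip-injective (suc M) {suc x} {suc y} eq = cong suc (skip-injective M (suc-injective eq))

skip-< : ∀ {M x} → x < M → skip M x ≡ x
skip-< {suc M} {zero}  _         = refl
skip-< {suc M} {suc x} (s≤s x<M) = cong suc (skip-< x<M)

skip-≥ : ∀ {M x} → M ≤ x → skip M x ≡ suc x
skip-≥ {zero}  {x}     _         = refl
skip-≥ {suc M} {suc x} (s≤s M≤x) = cong suc (skip-≥ M≤x)

map-skip-below : ∀ M c k → c + k ≤ M → map (skip M) (range c k) ≡ range c k
map-skip-below M c k c+k≤M = map-id-local (All.map (λ x<c+k → skip-< (<-≤-trans x<c+k c+k≤M)) (range-< c k))

map-skip-above : ∀ M c k → M ≤ c → map (skip M) (range c k) ≡ range (suc c) k
map-skip-above M c zero    _   = refl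
map-skip-above M c (suc k) M≤c = cong₂ _∷_ (skip-≥ M≤c) (map-skip-above M (suc c) k (m≤n⇒m≤1+n M≤c))

remove-range : ∀ m j → remove (suc m) (range 1 (suc m + j)) ≡ map (skip (suc m)) (range 1 (m + j))
remove-range m j = begin
  remove (suc m) (range 1 (suc m + j))
    ≡⟨ cong (remove (suc m) ∘ range 1) (+-suc m j) ⟨
  remove (suc m) (range 1 (m + suc j))
    ≡⟨ cong (remove (suc m)) (range-++ 1 m (suc j)) ⟩
  remove (suc m) (range 1 m ++ suc m ∷ range (2 + m) j)
    ≡⟨ filter-++ (λ x → ¬? (x ≟ suc m)) (range 1 m) _ ⟩
  remove (suc m) (range 1 m) ++ remove (suc m) (suc m ∷ range (2 + m) j)
    ≡⟨ cong₂ _++_ (remove-all (All.map <⇒≢ (range-< 1 m)))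
                  (trans (remove-head (suc m) _) (remove-all (All.map >⇒≢ (range-≥ (2 + m) j)))) ⟩
  range 1 m ++ range (2 + m) j
    ≡⟨ cong₂ _++_ (map-skip-below (suc m) 1 m ≤-refl) (map-skip-above (suc m) (suc m) j ≤-refl) ⟨
  map (skip (suc m)) (range 1 m) ++ map (skip (suc m)) (range (suc m) j)
    ≡⟨ map-++ (skip (suc m)) (range 1 m) _ ⟨
  map (skip (suc m)) (range 1 m ++ range (1 + m) j)
    ≡⟨ cong (map (skip (suc m))) (range-++ 1 m j) ⟨
  map (skip (suc m)) (range 1 (m + j)) ∎

-- The first row of the insertion tableau

insertRow : List ℕ → ℕ → List ℕ
insertRow r x = proj₁ (rowInsert x r)

firstRow : List ℕ → List ℕ
firstRow = foldl insertRow []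

insertAll : Tableau → List ℕ → Tableau
insertAll = foldl (λ T x → insertT x T)

topRow : Tableau → List ℕ
topRow []      = []
topRow (r ∷ _) = r

topRow-insertT : ∀ x T → topRow (insertT x T) ≡ insertRow (topRow T) x
topRow-insertT x []       = refl
topRow-insertT x (r ∷ rs) with rowInsert x r
... | _ , nothing = refl
... | _ , just _  = refl

topRow-insertAll : ∀ T w → topRow (insertAll T w) ≡ foldl insertRow (topRow T) w
topRow-insertAll T []      = refl
topRow-insertAll T (x ∷ w) =
  trans (topRow-insertAll (insertT x T) w) (cong (λ r → foldl insertRow r w) (topRow-insertT x T))

nonOnes : List ℕ → ℕ
nonOnes []      = 0
nonOnes (y ∷ r) = if y ≡ᵇ 1 then nonOnes r else suc (nonOnes r)

onlyOnes : List ℕ → Bool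
onlyOnes r = nonOnes r ≡ᵇ 0

module _ {f : ℕ → ℕ} (f-<ᵇ : ∀ x y → (f x <ᵇ f y) ≡ (x <ᵇ y)) where

  insertRow-map : ∀ r x → insertRow (map f r) (f x) ≡ map f (insertRow r x)
  insertRow-map []      x = refl
  insertRow-map (y ∷ r) x rewrite f-<ᵇ x y with x <ᵇ y
  ... | true  = refl
  ... | false = cong (f y ∷_) (insertRow-map r x)

  foldl-insertRow-map : ∀ r w → foldl insertRow (map f r) (map f w) ≡ map f (foldl insertRow r w)
  foldl-insertRow-map r []      = refl
  foldl-insertRow-map r (x ∷ w) =
    trans (cong (λ r′ → foldl insertRow r′ (map f w)) (insertRow-map r x)) (foldl-insertRow-map (insertRow r x) w)

  firstRow-map : ∀ w → firstRow (map f w) ≡ map f (firstRow w)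
  firstRow-map = foldl-insertRow-map []

nonOnes-map : ∀ {f : ℕ → ℕ} → (∀ x → (f x ≡ᵇ 1) ≡ (x ≡ᵇ 1)) → ∀ r → nonOnes (map f r) ≡ nonOnes r
nonOnes-map f-≡ᵇ1 []      = refl
nonOnes-map f-≡ᵇ1 (y ∷ r) rewrite f-≡ᵇ1 y with y ≡ᵇ 1
... | true  = nonOnes-map f-≡ᵇ1 r
... | false = cong suc (nonOnes-map f-≡ᵇ1 r)

nonOnes-∷-≤ : ∀ y r → nonOnes (y ∷ r) ≤ suc (nonOnes r)
nonOnes-∷-≤ y r with y ≡ᵇ 1
... | true  = n≤1+n _
... | false = ≤-refl

nonOnes-≤-∷ : ∀ y r → nonOnes r ≤ nonOnes (y ∷ r)
nonOnes-≤-∷ y r with y ≡ᵇ 1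
... | true  = ≤-refl
... | false = n≤1+n _

nonOnes-∷-mono : ∀ y d r r′ → nonOnes r ≤ d + nonOnes r′ → nonOnes (y ∷ r) ≤ d + nonOnes (y ∷ r′)
nonOnes-∷-mono y d r r′ r≤ with y ≡ᵇ 1
... | true  = r≤
... | false = ≤-trans (s≤s r≤) (≤-reflexive (sym (+-suc d _)))

nonOnes-insertRow : ∀ r x → nonOnes r ≤ suc (nonOnes (insertRow r x))
nonOnes-insertRow []      x = z≤n
nonOnes-insertRow (y ∷ r) x with x <ᵇ y
... | true  = ≤-trans (nonOnes-∷-≤ y r) (s≤s (nonOnes-≤-∷ x r))
... | false = nonOnes-∷-mono y 1 r (insertRow r x) (nonOnes-insertRow r x)

nonOnes-insertRow-≥2 : ∀ r {x} → 2 ≤ x → nonOnes r ≤ nonOnes (insertRow r x)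
nonOnes-insertRow-≥2 []      _          = z≤n
nonOnes-insertRow-≥2 (y ∷ r) {x} 2≤x@(s≤s (s≤s _)) with x <ᵇ y
... | true  = nonOnes-∷-≤ y r
... | false = nonOnes-∷-mono y 0 r (insertRow r x) (nonOnes-insertRow-≥2 r 2≤x)

cons1 : Tableau → Tableau
cons1 []       = (1 ∷ []) ∷ []
cons1 (r ∷ rs) = (1 ∷ r) ∷ rs

insertT-cons1 : ∀ {x} T → 1 ≤ x → insertT x (cons1 T) ≡ cons1 (insertT x T)
insertT-cons1 {suc x} []       _ = refl
insertT-cons1 {suc x} (r ∷ rs) _ with rowInsert (suc x) r
... | _ , nothing = refl
... | _ , just _  = refl

insertAll-cons1 : ∀ T w → All (1 ≤_) w → insertAll (cons1 T) w ≡ cons1 (insertAll T w)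
insertAll-cons1 T []      []           = refl
insertAll-cons1 T (x ∷ w) (1≤x ∷ 1≤w) =
  trans (cong (λ S → insertAll S w) (insertT-cons1 T 1≤x)) (insertAll-cons1 (insertT x T) w 1≤w)

RowInsertShape : ℕ → List ℕ → List ℕ × Maybe ℕ → Set
RowInsertShape x r (r′ , nothing) = r′ ≡ r ∷ʳ x
RowInsertShape x r (r′ , just _)  = length r′ ≡ length r

rowInsert-shape : ∀ x r → RowInsertShape x r (rowInsert x r)
rowInsert-shape x []      = refl
rowInsert-shape x (y ∷ r) with x <ᵇ y
... | true  = refl
... | false with rowInsert x r | rowInsert-shape x r
...   | _ , nothing | r′≡r∷ʳx  = cong (y ∷_) r′≡r∷ʳx
...   | _ , just _  | |r′|≡|r| = cong suc |r′|≡|r|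

nonOnes≡0⇒rowInsert1 : ∀ r → nonOnes r ≡ 0 → rowInsert 1 r ≡ (r ∷ʳ 1 , nothing)
nonOnes≡0⇒rowInsert1 []                _  = refl
nonOnes≡0⇒rowInsert1 (1 ∷ r)           e  rewrite nonOnes≡0⇒rowInsert1 r e = refl
nonOnes≡0⇒rowInsert1 (0 ∷ r)           ()
nonOnes≡0⇒rowInsert1 (suc (suc _) ∷ r) ()

nonOnes≡0⇒1∷r≡r∷ʳ1 : ∀ r → nonOnes r ≡ 0 → 1 ∷ r ≡ r ∷ʳ 1
nonOnes≡0⇒1∷r≡r∷ʳ1 []                _  = refl
nonOnes≡0⇒1∷r≡r∷ʳ1 (1 ∷ r)           e  = cong (1 ∷_) (nonOnes≡0⇒1∷r≡r∷ʳ1 r e)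
nonOnes≡0⇒1∷r≡r∷ʳ1 (0 ∷ r)           ()
nonOnes≡0⇒1∷r≡r∷ʳ1 (suc (suc _) ∷ r) ()

1∷r≡r∷ʳ1⇒nonOnes≡0 : ∀ r → 1 ∷ r ≡ r ∷ʳ 1 → nonOnes r ≡ 0
1∷r≡r∷ʳ1⇒nonOnes≡0 []      _ = refl
1∷r≡r∷ʳ1⇒nonOnes≡0 (y ∷ r) e with ∷-injective e
... | refl , e′ = 1∷r≡r∷ʳ1⇒nonOnes≡0 r e′

cons1≡insertT1 : ∀ r rs → nonOnes r ≡ 0 → cons1 (r ∷ rs) ≡ insertT 1 (r ∷ rs)
cons1≡insertT1 r rs e rewrite nonOnes≡0⇒rowInsert1 r e = cong (_∷ rs) (nonOnes≡0⇒1∷r≡r∷ʳ1 r e)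

cons1≢insertT1 : ∀ r rs → nonOnes r ≢ 0 → cons1 (r ∷ rs) ≢ insertT 1 (r ∷ rs)
cons1≢insertT1 r rs nonOnes≢0 eq with rowInsert 1 r | rowInsert-shape 1 r
... | _ , nothing | r′≡r∷ʳ1  = nonOnes≢0 (1∷r≡r∷ʳ1⇒nonOnes≡0 r (trans (∷-injectiveˡ eq) r′≡r∷ʳ1))
... | _ , just _  | |r′|≡|r| = 1+n≢n (trans (cong length (∷-injectiveˡ eq)) |r′|≡|r|)

cons1≟insertT1 : ∀ T → does (cons1 T ≟T insertT 1 T) ≡ onlyOnes (topRow T)
cons1≟insertT1 []       = refl
cons1≟insertT1 (r ∷ rs) with nonOnes r in e
... | zero  = dec-true  (cons1 (r ∷ rs) ≟T insertT 1 (r ∷ rs)) (cons1≡insertT1 r rs e)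
... | suc _ = dec-false (cons1 (r ∷ rs) ≟T insertT 1 (r ∷ rs))
                        (cons1≢insertT1 r rs (λ e₀ → 1+n≢0 (trans (sym e) e₀)))

commutes-with-1 : ∀ w → All (1 ≤_) w → does (P (1 ∷ w) ≟T P (w ∷ʳ 1)) ≡ onlyOnes (firstRow w)
commutes-with-1 w 1≤w = begin
  does (P (1 ∷ w) ≟T P (w ∷ʳ 1))
    ≡⟨ cong₂ (λ S T → does (S ≟T T)) (insertAll-cons1 [] w 1≤w) (foldl-∷ʳ (λ T x → insertT x T) [] 1 w) ⟩
  does (cons1 (P w) ≟T insertT 1 (P w))
    ≡⟨ cons1≟insertT1 (P w) ⟩
  onlyOnes (topRow (P w))
    ≡⟨ cong onlyOnes (topRow-insertAll [] w) ⟩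
  onlyOnes (firstRow w) ∎

-- Pascal's recurrence

coverCount : ℕ → ℕ → ℕ → ℕ
coverCount n m j = count n (range 1 (m + j)) (λ w → covers (range (suc m) j) w ∧ onlyOnes (firstRow w))

c1≡coverCount : ∀ n m → c1 n m ≡ coverCount n m 0
c1≡coverCount n m = begin
  c1 n m
    ≡⟨ length-filter-words n m (λ w → P (1 ∷ w) ≟T P (w ∷ʳ 1)) ⟩
  count n (letters m) (λ w → does (P (1 ∷ w) ≟T P (w ∷ʳ 1)))
    ≡⟨ cong (λ L → count n L _) (trans (letters≡range m) (cong (range 1) (sym (+-identityʳ m)))) ⟩
  count n (range 1 (m + 0)) (λ w → does (P (1 ∷ w) ≟T P (w ∷ʳ 1)))
    ≡⟨ count-cong-All n (range-≥ 1 (m + 0)) commutes-with-1 ⟩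
  coverCount n m 0 ∎

coverCount-pascal : ∀ n m j → coverCount n (2 + m) j ≡ coverCount n (suc m) j + coverCount n (suc m) (suc j)
coverCount-pascal n m j = begin
  count n L p
    ≡⟨ count-split n L p (occurs a) ⟩
  count n L (λ w → p w ∧ occurs a w) + count n L (λ w → p w ∧ not (occurs a w))
    ≡⟨ cong₂ _+_ containing avoiding ⟩
  coverCount n (suc m) (suc j) + coverCount n (suc m) j
    ≡⟨ +-comm (coverCount n (suc m) (suc j)) _ ⟩
  coverCount n (suc m) j + coverCount n (suc m) (suc j) ∎
  where
  a = 2 + m
  L = range 1 (a + j)
  p : List ℕ → Bool
  p w = covers (range (suc a) j) w ∧ onlyOnes (firstRow w)

  containing : count n L (λ w → p w ∧ occurs a w) ≡ coverCount n (suc m) (suc j)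
  containing = trans
    (count-cong n L (λ w → trans (∧-comm (p w) (occurs a w))
                                (sym (∧-assoc (occurs a w) (covers (range (suc a) j) w) (onlyOnes (firstRow w))))))
    (cong (λ k → count n (range 1 k) (λ w → covers (range a (suc j)) w ∧ onlyOnes (firstRow w))) (sym (+-suc (suc m) j)))

  skip-fixes-1 : ∀ x → (skip a x ≡ᵇ 1) ≡ (x ≡ᵇ 1)
  skip-fixes-1 x = ≡ᵇ-injective (skip-injective a) x 1

  relabel : ∀ w → p (map (skip a) w) ≡ covers (range a j) w ∧ onlyOnes (firstRow w)
  relabel w = cong₂ _∧_
    (trans (cong (λ R → covers R (map (skip a) w)) (sym (map-skip-above a a j ≤-refl)))
           (covers-map (skip-injective a) (range a j) w))
    (cong (_≡ᵇ 0) (trans (cong nonOnes (firstRow-map (skip-<ᵇ a) w)) (nonOnes-map skip-fixes-1 (firstRow w))))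

  avoiding : count n L (λ w → p w ∧ not (occurs a w)) ≡ coverCount n (suc m) j
  avoiding = begin
    count n L (λ w → p w ∧ not (occurs a w))                ≡⟨ count-avoid n L p a ⟩
    count n (remove a L) p                                  ≡⟨ cong (λ K → count n K p) (remove-range (suc m) j) ⟩
    count n (map (skip a) (range 1 (suc m + j))) p          ≡⟨ count-map n (skip a) _ p ⟩
    count n (range 1 (suc m + j)) (p ∘ map (skip a))        ≡⟨ count-cong n _ relabel ⟩
    coverCount n (suc m) j                                  ∎

-- Pruned search

State : Set
State = List ℕ × List ℕ

step : State → ℕ → State
step (r , R) b = insertRow r b , remove b R

run : State → List ℕ → State
run (r , R) w = foldl insertRow r w , missing R w

accepting : State → Bool
accepting (r , R) = null R ∧ onlyOnes r

potential : State → ℕ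
potential (r , R) = nonOnes r + length R

search : ℕ → List ℕ → State → ℕ
search zero    L s = if accepting s then 1 else 0
search (suc n) L s = if suc n <ᵇ potential s then 0 else sum (map (search n L ∘ step s) L)

Admissible : List ℕ → Set
Admissible R = Unique R × All (2 ≤_) R

admissible-remove : ∀ b {R} → Admissible R → Admissible (remove b R)
admissible-remove b (unique , 2≤R) = Unique.filter⁺ (λ x → ¬? (x ≟ b)) unique , All.filter⁺ (λ x → ¬? (x ≟ b)) 2≤R

length-remove : ∀ b {R} → Unique R → length R ≤ suc (length (remove b R))
length-remove b {[]}    AllPairs.[]             = z≤n
length-remove b {x ∷ R} (x≢R AllPairs.∷ unique) with x ≟ b
... | yes refl = ≤-reflexive (cong (suc ∘ length) (sym (trans (remove-head b R) (remove-all (All.map ≢-sym x≢R)))))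
... | no  x≢b  = ≤-trans (s≤s (length-remove b unique)) (≤-reflexive (cong (suc ∘ length) (sym (remove-other R x≢b))))

potential-step : ∀ r R {b} → Admissible R → 1 ≤ b → potential (r , R) ≤ suc (potential (step (r , R) b))
potential-step r R {1} (_ , 2≤R) _ rewrite remove-all (All.map >⇒≢ 2≤R) =
  +-monoˡ-≤ (length R) (nonOnes-insertRow r 1)
potential-step r R {suc (suc b)} (unique , _) _ =
  ≤-trans (+-mono-≤ (nonOnes-insertRow-≥2 r (s≤s (s≤s z≤n))) (length-remove (suc (suc b)) unique))
          (≤-reflexive (+-suc _ _))

accepting-potential : ∀ s → 0 < potential s → accepting s ≡ false
accepting-potential (r , _ ∷ _) _ = refl
accepting-potential (r , [])    0<pot with nonOnes r | 0<pot
... | suc _ | _ = refl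

prune : ∀ n L s → All (1 ≤_) L → Admissible (proj₂ s) → n < potential s → count n L (accepting ∘ run s) ≡ 0
prune zero    L s       _   _   0<pot = cong (if_then 1 else 0) (accepting-potential s 0<pot)
prune (suc n) L (r , R) 1≤L adm n<pot = sum-map-zero (All.map dead-end 1≤L)
  where
  dead-end : ∀ {b} → 1 ≤ b → count n L (accepting ∘ run (step (r , R) b)) ≡ 0
  dead-end 1≤b = prune n L (step (r , R) _) 1≤L (admissible-remove _ adm)
                       (≤-pred (≤-trans n<pot (potential-step r R adm 1≤b)))

search≡count : ∀ n L s → All (1 ≤_) L → Admissible (proj₂ s) → search n L s ≡ count n L (accepting ∘ run s)
search≡count zero    L s       _   _   = refl
search≡count (suc n) L (r , R) 1≤L adm with suc n <ᵇ potential (r , R) in pruned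
... | true  = sym (prune (suc n) L (r , R) 1≤L adm (<ᵇ⇒< (suc n) _ (subst T (sym pruned) _)))
... | false = cong sum (map-cong-local (All.map (λ _ → search≡count n L (step (r , R) _) 1≤L (admissible-remove _ adm)) 1≤L))

-- The expansion

initial : ℕ → State
initial j = [] , range 2 j

coverCount≡count-accepting : ∀ n j → coverCount n 1 j ≡ count n (range 1 (suc j)) (accepting ∘ run (initial j))
coverCount≡count-accepting n j =
  count-cong n (range 1 (suc j)) (λ w → cong (_∧ onlyOnes (firstRow w)) (sym (null-missing (range 2 j) w)))

initial-admissible : ∀ j → Admissible (range 2 j)
initial-admissible j = range-unique 2 j , range-≥ 2 j

coverCount≡search : ∀ n j → coverCount n 1 j ≡ search n (range 1 (suc j)) (initial j)
coverCount≡search n j = trans (coverCount≡count-accepting n j)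
  (sym (search≡count n (range 1 (suc j)) (initial j) (range-≥ 1 (suc j)) (initial-admissible j)))

coverCount-vanishes : ∀ n j → n < j → coverCount n 1 j ≡ 0
coverCount-vanishes n j n<j = trans (coverCount≡count-accepting n j)
  (prune n (range 1 (suc j)) (initial j) (range-≥ 1 (suc j)) (initial-admissible j)
         (subst (n <_) (sym (length-iterate suc 2 j)) n<j))

applyUpTo-≡⇒ : ∀ {A : Set} (f g : ℕ → A) n → applyUpTo f n ≡ applyUpTo g n → ∀ {k} → k < n → f k ≡ g k
applyUpTo-≡⇒ f g (suc n) eq {zero}  _         = ∷-injectiveˡ eq
applyUpTo-≡⇒ f g (suc n) eq {suc k} (s≤s k<n) = applyUpTo-≡⇒ (f ∘ suc) (g ∘ suc) n (∷-injectiveʳ eq) k<n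

coverCounts : ℕ → List ℕ
coverCounts n = applyUpTo (λ j → search n (range 1 (suc j)) (initial j)) (suc n)

c1≡binomialSum : ∀ bs → .{{_ : NonZero (length bs)}} →
                 coverCounts (length bs) ≡ applyUpTo (λ j → coeff bs j + coeff bs (suc j)) (suc (length bs)) →
                 ∀ m → length bs ≤ m → c1 (length bs) m ≡ binomialSum bs m
c1≡binomialSum bs table zero    n≤0 = contradiction (n≤0⇒n≡0 n≤0) (≢-nonZero⁻¹ (length bs))
c1≡binomialSum bs table (suc m) _   = begin
  c1 n (suc m)                             ≡⟨ c1≡coverCount n (suc m) ⟩
  H (suc m) 0                              ≡⟨ binomial-transform n H (λ j → coeff-≥ bs) H-pascal (suc m) 0 ⟩
  ∑ n (λ k → coeff bs k * (suc m C k))     ≡⟨ binomialSum≡∑ bs (suc m) ⟨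
  binomialSum bs (suc m)                   ∎
  where
  n = length bs

  H : ℕ → ℕ → ℕ
  H zero    = coeff bs
  H (suc m) = coverCount n (suc m)

  H-pascal : ∀ m j → H (suc m) j ≡ H m j + H m (suc j)
  H-pascal (suc m) j = coverCount-pascal n m j
  H-pascal zero    j with j ≤? n
  ... | yes j≤n = trans (coverCount≡search n j)
                        (applyUpTo-≡⇒ (λ j → search n (range 1 (suc j)) (initial j)) (λ j → coeff bs j + coeff bs (suc j))
                                      (suc n) table (s≤s j≤n))
  ... | no  j≰n = let n≤j = <⇒≤ (≰⇒> j≰n) in
                  trans (coverCount-vanishes n j (≰⇒> j≰n))
                        (sym (cong₂ _+_ (coeff-≥ bs n≤j) (coeff-≥ bs (m≤n⇒m≤1+n n≤j))))

theorem5p7 : (∀ m → 1 ≤ m → c1 1 m ≡ 1)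
    × (∀ m → 2 ≤ m → c1 2 m ≡ (m C 1))
    × (∀ m → 3 ≤ m → c1 3 m ≡ (m C 1) + (m C 2))
    × (∀ m → 4 ≤ m → c1 4 m ≡ (m C 1) + 4 * (m C 2) + (m C 3))
    × (∀ m → 5 ≤ m → c1 5 m ≡ (m C 1) + 8 * (m C 2) + 13 * (m C 3) + (m C 4))
    × (∀ m → 6 ≤ m → c1 6 m ≡ (m C 1) + 18 * (m C 2) + 48 * (m C 3) + 41 * (m C 4) + (m C 5))
    × (∀ m → 7 ≤ m → c1 7 m ≡ (m C 1) + 33 * (m C 2) + 178 * (m C 3) + 262 * (m C 4) + 131 * (m C 5) + (m C 6))
    × (∀ m → 8 ≤ m → c1 8 m ≡ (m C 1) + 68 * (m C 2) + 549 * (m C 3) + 1480 * (m C 4) + 1405 * (m C 5) + 428 * (m C 6) + (m C 7))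
theorem5p7 =
    c1≡binomialSum (1 ∷ []) refl
  , c1≡binomialSum (0 ∷ 1 ∷ []) refl
  , c1≡binomialSum (0 ∷ 1 ∷ 1 ∷ []) refl
  , c1≡binomialSum (0 ∷ 1 ∷ 4 ∷ 1 ∷ []) refl
  , c1≡binomialSum (0 ∷ 1 ∷ 8 ∷ 13 ∷ 1 ∷ []) refl
  , c1≡binomialSum (0 ∷ 1 ∷ 18 ∷ 48 ∷ 41 ∷ 1 ∷ []) refl
  , c1≡binomialSum (0 ∷ 1 ∷ 33 ∷ 178 ∷ 262 ∷ 131 ∷ 1 ∷ []) refl
  , c1≡binomialSum (0 ∷ 1 ∷ 68 ∷ 549 ∷ 1480 ∷ 1405 ∷ 428 ∷ 1 ∷ []) refl
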